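{- The tape theory (over any finite tape alphabet $\Gamma=\{\gamma_1,\ldots,\gamma_n\}$) is not finitely axiomatizable, i.e. there is no finite set of equations whose deductive closure under equational logic is the tape theory.
   Context: Notation: for $i\in\mathbb{Z}$, $k\ge0$, $\sigma,\sigma':\mathbb{Z}\to\Gamma$, $\sigma=_{i\pm k}\sigma'$ means $\sigma(j)=\sigma'(j)$ for all $|i-j|\le k$, and $\sigma=^{i\pm k}\sigma'$ means this for all $|i-j|>k$; $\sigma_{+j}=\sigma\circ(\lambda i.\,i+j)$. The tape monad over $\Gamma$: $TX$ consists of the maps $\langle r,z,t\rangle:\mathbb{Z}\times\Gamma^{\mathbb{Z}}\to X\times\mathbb{Z}\times\Gamma^{\mathbb{Z}}$ for which there is $k\ge0$ such that for all $i,j\in\mathbb{Z}$ and $\sigma,\sigma'$ with $\sigma=_{i\pm k}\sigma'$: $t(i,\sigma)=_{i\pm k}t(i,\sigma')$, $r(i,\sigma)=r(i,\sigma')$, $|z(i,\sigma)-i|\le k$, $t(i,\sigma)=^{i\pm k}\sigma$, $z(i,\sigma)=z(i,\sigma')$, $t(i,\sigma_{+j})=t(i+j,\sigma)_{+j}$, $r(i,\sigma_{+j})=r(i+j,\sigma)$, $z(i,\sigma_{+j})=z(i+j,\sigma)-j$ (monad structure inherited from the store monad). The tape signature consists of $read$ ($n$-ary), $write_i$ (unary, $1\le i\le n$), $lmove$, $rmove$ (unary), interpreted over each $TX$ (writing elements of $TX$ as functions of $(z,\sigma)$) by $[\![read]\!](p_1,\ldots,p_n)(z,\sigma)=p_l(z,\sigma)$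 where $\sigma(z)=\gamma_l$; $[\![write_i]\!](p)(z,\sigma)=p(z,\sigma[z\mapsto\gamma_i])$; $[\![lmove]\!](p)(z,\sigma)=p(z-1,\sigma)$; $[\![rmove]\!](p)(z,\sigma)=p(z+1,\sigma)$. The tape theory is the set of all equations $p=q$ in the tape signature that are valid over every $TX$. -}

module Defs where

open import Data.Nat as ℕ using (ℕ)
open import Data.Fin using (Fin)
open import Data.Integer as ℤ using (ℤ; ∣_∣; _-_; _+_; 1ℤ)
open import Data.Bool using (if_then_else_)
open import Data.List using (List)
open import Data.List.Membership.Propositional using (_∈_)
open import Data.Product using (_×_; _,_; proj₁; proj₂)
open import Relation.Nullary using (does)
open import Relation.Binary.PropositionalEquality using (_≡_)

-- Tapes over the alphabet Γ = {γ₁,…,γₙ}, represented by Fin n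
-- (γ_l is the element l of Fin n).

Tape : ℕ → Set
Tape n = ℤ → Fin n

module _ {n : ℕ} where

  _=⟨_±_⟩_ : Tape n → ℤ → ℕ → Tape n → Set
  σ =⟨ i ± k ⟩ σ' = ∀ j → ∣ i - j ∣ ℕ.≤ k → σ j ≡ σ' j

  _=^⟨_±_⟩_ : Tape n → ℤ → ℕ → Tape n → Set
  σ =^⟨ i ± k ⟩ σ' = ∀ j → k ℕ.< ∣ i - j ∣ → σ j ≡ σ' j

  _₊_ : Tape n → ℤ → Tape n
  (σ ₊ j) i = σ (i + j)

  _[_↦_] : Tape n → ℤ → Fin n → Tape n
  (σ [ z ↦ γ ]) j = if does (j ℤ.≟ z) then γ else σ j

-- The tape monad T X (elements of the store monad satisfying the
-- locality / translation-invariance conditions).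

record T (n : ℕ) (X : Set) : Set where
  field
    r : ℤ → Tape n → X
    z : ℤ → Tape n → ℤ
    t : ℤ → Tape n → Tape n
    k : ℕ
    cond : ∀ (i j : ℤ) (σ σ' : Tape n) → σ =⟨ i ± k ⟩ σ' →
             (t i σ =⟨ i ± k ⟩ t i σ')
           × (r i σ ≡ r i σ')
           × (∣ z i σ - i ∣ ℕ.≤ k)
           × (t i σ =^⟨ i ± k ⟩ σ)
           × (z i σ ≡ z i σ')
           × (t i (σ ₊ j) ≡ (t (i + j) σ) ₊ j)
           × (r i (σ ₊ j) ≡ r (i + j) σ)
           × (z i (σ ₊ j) ≡ z (i + j) σ - j)

  run : ℤ → Tape n → X × ℤ × Tape n
  run i σ = r i σ , z i σ , t i σ

Raw : ℕ → Set → Set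
Raw n X = ℤ → Tape n → X × ℤ × Tape n

_≋_ : ∀ {n X} → X × ℤ × Tape n → X × ℤ × Tape n → Set
(x , z , σ) ≋ (x' , z' , σ') = x ≡ x' × z ≡ z' × (∀ j → σ j ≡ σ' j)

data Term (n : ℕ) : Set where
  var   : ℕ → Term n
  read  : (Fin n → Term n) → Term n
  write : Fin n → Term n → Term n
  lmove : Term n → Term n
  rmove : Term n → Term n

Equation : ℕ → Set
Equation n = Term n × Term n

⟦_⟧ : ∀ {n X} → Term n → (ℕ → T n X) → Raw n X
⟦ var x ⟧     v z σ = T.run (v x) z σ
⟦ read f ⟧    v z σ = ⟦ f (σ z) ⟧ v z σ
⟦ write i p ⟧ v z σ = ⟦ p ⟧ v z (σ [ z ↦ i ])
⟦ lmove p ⟧   v z σ = ⟦ p ⟧ v (z - 1ℤ) σ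
⟦ rmove p ⟧   v z σ = ⟦ p ⟧ v (z + 1ℤ) σ

Valid : ∀ {n} → Term n → Term n → Set₁
Valid {n} p q = ∀ (X : Set) (v : ℕ → T n X) (z : ℤ) (σ : Tape n) →
  ⟦ p ⟧ v z σ ≋ ⟦ q ⟧ v z σ

InTapeTheory : ∀ {n} → Equation n → Set₁
InTapeTheory (p , q) = Valid p q

sub : ∀ {n} → (ℕ → Term n) → Term n → Term n
sub s (var x)     = s x
sub s (read f)    = read (λ i → sub s (f i))
sub s (write i p) = write i (sub s p)
sub s (lmove p)   = lmove (sub s p)
sub s (rmove p)   = rmove (sub s p)

data _⊢_≈_ {n : ℕ} (E : List (Equation n)) : Term n → Term n → Set where
  axiom  : ∀ {p q} → (p , q) ∈ E → (s : ℕ → Term n) → E ⊢ sub s p ≈ sub s q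
  refl   : ∀ {p} → E ⊢ p ≈ p
  sym    : ∀ {p q} → E ⊢ p ≈ q → E ⊢ q ≈ p
  trans  : ∀ {p q u} → E ⊢ p ≈ q → E ⊢ q ≈ u → E ⊢ p ≈ u
  cong-read  : ∀ {f g} → (∀ i → E ⊢ f i ≈ g i) → E ⊢ read f ≈ read g
  cong-write : ∀ {i p q} → E ⊢ p ≈ q → E ⊢ write i p ≈ write i q
  cong-lmove : ∀ {p q} → E ⊢ p ≈ q → E ⊢ lmove p ≈ lmove q
  cong-rmove : ∀ {p q} → E ⊢ p ≈ q → E ⊢ rmove p ≈ rmove q

Axiomatizes : ∀ {n} → List (Equation n) → Set₁
Axiomatizes {n} E = ∀ (e : Equation n) →
  (E ⊢ proj₁ e ≈ proj₂ e → InTapeTheory e)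
  × (InTapeTheory e → E ⊢ proj₁ e ≈ proj₂ e)

-- A run whose head stays within distance B of its start cannot tell the honest
-- tape from one whose cells are addressed through a map π that is injective on
-- balls of radius B, so a valid equation between such terms also holds in the
-- model aliased by π. Given finitely many axioms, let B bound the head excursions
-- of their terms and let π fold the cell L onto the cell 0, where L > 2B: every
-- axiom, hence every consequence of the axioms, holds in the aliased model. But
-- writes to the distinct cells 0 and L commute in every TX, whereas under π they
-- hit the same cell and the later write wins.
module Submission where

open import Defs
open import Data.Nat using (ℕ; _≤_)
open import Data.List using (List)
open import Data.Product using (Σ)
open import Relation.Nullary using (¬_)

import Data.Nat as ℕ
open import Data.Nat using (zero; suc; _<_; _⊔_; _≤?_)
open import Data.Nat.Properties
  using (≤-refl; ≤-trans; ≤-reflexive; <-irrefl; ≰⇒>; +-assoc; +-identityʳ; +-mono-≤; +-monoʳ-≤;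
         +-monoˡ-≤; m+n≤o⇒m≤o; m≤m⊔n; m≤n⊔m; m≤n⇒m≤o⊔n; m≤n⇒m≤n⊔o)
open import Data.Integer as ℤ using (ℤ; +_; -_; _+_; _-_; ∣_∣; 0ℤ; 1ℤ)
import Data.Integer.Properties as ℤₚ
open import Data.Integer.Tactic.RingSolver using (solve-∀)
open import Data.Fin using (Fin) renaming (zero to fzero; suc to fsuc)
open import Data.Bool using (if_then_else_)
open import Data.List using ([]; _∷_)
open import Data.List.Membership.Propositional using (_∈_)
open import Data.List.Relation.Unary.Any using (here; there)
open import Data.Product using (_×_; _,_; proj₁; proj₂; ∃-syntax)
open import Data.Sum using (_⊎_; inj₁; inj₂)
open import Data.Empty using (⊥-elim)
open import Function using (_∘_)
open import Relation.Nullary using (yes; no; does)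
open import Relation.Nullary.Decidable using (dec-true)
open import Relation.Binary.PropositionalEquality as Eq
  using (_≡_; _≢_; refl; cong; subst; subst₂; module ≡-Reasoning)

open ≡-Reasoning

[i+j]-j≡i : ∀ i j → (i + j) - j ≡ i
[i+j]-j≡i = solve-∀

[i+j]-i≡j : ∀ i j → (i + j) - i ≡ j
[i+j]-i≡j = solve-∀

∣i-i∣≡0 : ∀ i → ∣ i - i ∣ ≡ 0
∣i-i∣≡0 i = cong ∣_∣ (ℤₚ.+-inverseʳ i)

dist-triangle : ∀ i j c → ∣ i - j ∣ ≤ ∣ i - c ∣ ℕ.+ ∣ j - c ∣
dist-triangle i j c = subst (λ d → ∣ d ∣ ≤ ∣ i - c ∣ ℕ.+ ∣ j - c ∣) (difference i j c)
                        (ℤₚ.∣i-j∣≤∣i∣+∣j∣ (i - c) (j - c))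
  where
  difference : ∀ i j c → (i - c) - (j - c) ≡ i - j
  difference = solve-∀

dist-move : ∀ w d c → ∣ (w + d) - c ∣ ≤ ∣ w - c ∣ ℕ.+ ∣ d ∣
dist-move w d c = subst (λ e → ∣ e ∣ ≤ ∣ w - c ∣ ℕ.+ ∣ d ∣) (reassoc w d c)
                    (ℤₚ.∣i+j∣≤∣i∣+∣j∣ (w - c) d)
  where
  reassoc : ∀ w d c → (w - c) + d ≡ (w + d) - c
  reassoc = solve-∀

i≢i+suc : ∀ i L → i ≢ i + + suc L
i≢i+suc i L e = 0≢suc[L] (begin
  0ℤ                  ≡⟨ ℤₚ.+-inverseʳ i ⟨
  i - i               ≡⟨ cong (_- i) e ⟩
  (i + + suc L) - i   ≡⟨ [i+j]-i≡j i (+ suc L) ⟩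
  + suc L             ∎)
  where
  0≢suc[L] : 0ℤ ≢ + suc L
  0≢suc[L] ()

module _ {n : ℕ} where

  update-same : (σ : Tape n) (x : ℤ) (γ : Fin n) → (σ [ x ↦ γ ]) x ≡ γ
  update-same σ x γ = cong (λ b → if b then γ else σ x) (dec-true (x ℤ.≟ x) refl)

  update-comm : (σ : Tape n) {x y : ℤ} (a b : Fin n) → x ≢ y →
                ∀ j → ((σ [ x ↦ a ]) [ y ↦ b ]) j ≡ ((σ [ y ↦ b ]) [ x ↦ a ]) j
  update-comm σ {x} {y} a b x≢y j with j ℤ.≟ y | j ℤ.≟ x
  ... | yes refl | yes refl = ⊥-elim (x≢y refl)
  ... | yes _    | no _     = refl
  ... | no _     | yes _    = refl
  ... | no _     | no _     = refl

module _ {n : ℕ} {X : Set} where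

  ≋-refl : (a : X × ℤ × Tape n) → a ≋ a
  ≋-refl _ = refl , refl , λ _ → refl

  ≋-sym : {a b : X × ℤ × Tape n} → a ≋ b → b ≋ a
  ≋-sym {_ , _ , _} {_ , _ , _} (x≡ , z≡ , σ≡) = Eq.sym x≡ , Eq.sym z≡ , Eq.sym ∘ σ≡

  ≋-trans : {a b c : X × ℤ × Tape n} → a ≋ b → b ≋ c → a ≋ c
  ≋-trans {_ , _ , _} {_ , _ , _} {_ , _ , _} (x≡ , z≡ , σ≡) (x≡' , z≡' , σ≡') =
    Eq.trans x≡ x≡' , Eq.trans z≡ z≡' , λ j → Eq.trans (σ≡ j) (σ≡' j)

  run-cong : (u : T n X) (i : ℤ) {σ σ' : Tape n} → (∀ j → σ j ≡ σ' j) →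
             T.run u i σ ≋ T.run u i σ'
  run-cong u i {σ} {σ'} σ≡σ' = r≡ , z≡ , t≡
    where
    open T u
    local = cond i 0ℤ σ σ' (λ j _ → σ≡σ' j)
    r≡ = proj₁ (proj₂ local)
    z≡ = proj₁ (proj₂ (proj₂ (proj₂ (proj₂ local))))
    frame : ∀ τ → t i τ =^⟨ i ± k ⟩ τ
    frame τ = proj₁ (proj₂ (proj₂ (proj₂ (cond i 0ℤ τ τ (λ _ _ → refl)))))
    t≡ : ∀ j → t i σ j ≡ t i σ' j
    t≡ j with ∣ i - j ∣ ≤? k
    ... | yes near = proj₁ local j near
    ... | no far   =
      Eq.trans (frame σ j (≰⇒> far)) (Eq.trans (σ≡σ' j) (Eq.sym (frame σ' j (≰⇒> far))))

pure : ∀ {n X} → X → T n X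
pure x = record
  { r = λ _ _ → x ; z = λ i _ → i ; t = λ _ σ → σ ; k = 0
  ; cond = λ i j _ _ σ≈σ' → σ≈σ' , refl , ≤-reflexive (∣i-i∣≡0 i) , (λ _ _ → refl)
                           , refl , refl , refl , Eq.sym ([i+j]-j≡i i j)
  }

rightBy leftBy : ∀ {n} → ℕ → Term n → Term n
rightBy zero    p = p
rightBy (suc m) p = rmove (rightBy m p)
leftBy  zero    p = p
leftBy  (suc m) p = lmove (leftBy m p)

writeAt : ∀ {n} → ℕ → Fin n → Term n → Term n
writeAt L γ p = rightBy L (write γ (leftBy L p))

module _ {n : ℕ} {A : Set} (F : Term n → ℤ → Tape n → A) where

  rightBy-shift : (∀ p z τ → F (rmove p) z τ ≡ F p (z + 1ℤ) τ) →
                  ∀ m p z τ → F (rightBy m p) z τ ≡ F p (z + + m) τ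
  rightBy-shift _    zero    p z τ = cong (λ w → F p w τ) (Eq.sym (ℤₚ.+-identityʳ z))
  rightBy-shift step (suc m) p z τ = begin
    F (rmove (rightBy m p)) z τ  ≡⟨ step (rightBy m p) z τ ⟩
    F (rightBy m p) (z + 1ℤ) τ   ≡⟨ rightBy-shift step m p (z + 1ℤ) τ ⟩
    F p (z + 1ℤ + + m) τ         ≡⟨ cong (λ w → F p w τ) (ℤₚ.+-assoc z 1ℤ (+ m)) ⟩
    F p (z + + suc m) τ          ∎

  leftBy-shift : (∀ p z τ → F (lmove p) z τ ≡ F p (z - 1ℤ) τ) →
                 ∀ m p z τ → F (leftBy m p) z τ ≡ F p (z - + m) τ
  leftBy-shift _    zero    p z τ = cong (λ w → F p w τ) (Eq.sym (ℤₚ.+-identityʳ z))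
  leftBy-shift step (suc m) p z τ = begin
    F (lmove (leftBy m p)) z τ   ≡⟨ step (leftBy m p) z τ ⟩
    F (leftBy m p) (z - 1ℤ) τ    ≡⟨ leftBy-shift step m p (z - 1ℤ) τ ⟩
    F p (z - 1ℤ - + m) τ         ≡⟨ cong (λ w → F p w τ) (reassoc z (+ m)) ⟩
    F p (z - + suc m) τ          ∎
    where
    reassoc : ∀ z m → z - 1ℤ - m ≡ z - (1ℤ + m)
    reassoc = solve-∀

  -- α z is the physical cell that a write at head position z modifies.
  writeAt-law : (α : ℤ → ℤ) →
                (∀ p z τ → F (rmove p) z τ ≡ F p (z + 1ℤ) τ) →
                (∀ p z τ → F (lmove p) z τ ≡ F p (z - 1ℤ) τ) →
                (∀ γ p z τ → F (write γ p) z τ ≡ F p z (τ [ α z ↦ γ ])) →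
                ∀ L γ p z τ → F (writeAt L γ p) z τ ≡ F p z (τ [ α (z + + L) ↦ γ ])
  writeAt-law α right left wr L γ p z τ = begin
    F (writeAt L γ p) z τ                ≡⟨ rightBy-shift right L (write γ (leftBy L p)) z τ ⟩
    F (write γ (leftBy L p)) (z + + L) τ ≡⟨ wr γ (leftBy L p) (z + + L) τ ⟩
    F (leftBy L p) (z + + L) τ'          ≡⟨ leftBy-shift left L p (z + + L) τ' ⟩
    F p ((z + + L) - + L) τ'             ≡⟨ cong (λ w → F p w τ') ([i+j]-j≡i z (+ L)) ⟩
    F p z τ'                             ∎
    where τ' = τ [ α (z + + L) ↦ γ ]

⟦writeAt⟧ : ∀ {n X} L γ p (v : ℕ → T n X) z σ →
            ⟦ writeAt L γ p ⟧ v z σ ≡ ⟦ p ⟧ v z (σ [ z + + L ↦ γ ])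
⟦writeAt⟧ L γ p v = writeAt-law (λ p → ⟦ p ⟧ v) (λ z → z)
                      (λ _ _ _ → refl) (λ _ _ _ → refl) (λ _ _ _ _ → refl) L γ p

-- Confinement of the head

data Confined {n} (B : ℕ) (c : ℤ) : ℤ → Term n → Set where
  var   : ∀ {w x} → Confined B c w (var x)
  read  : ∀ {w f} → ∣ w - c ∣ ≤ B → (∀ γ → Confined B c w (f γ)) → Confined B c w (read f)
  write : ∀ {w γ p} → ∣ w - c ∣ ≤ B → Confined B c w p → Confined B c w (write γ p)
  lmove : ∀ {w p} → Confined B c (w - 1ℤ) p → Confined B c w (lmove p)
  rmove : ∀ {w p} → Confined B c (w + 1ℤ) p → Confined B c w (rmove p)

confined-sub-var : ∀ {n B c w} {p : Term n} → Confined B c w p → Confined B c w (sub var p)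
confined-sub-var var          = var
confined-sub-var (read h cf)  = read h (confined-sub-var ∘ cf)
confined-sub-var (write h cp) = write h (confined-sub-var cp)
confined-sub-var (lmove cp)   = lmove (confined-sub-var cp)
confined-sub-var (rmove cp)   = rmove (confined-sub-var cp)

⨆ : ∀ {m} → (Fin m → ℕ) → ℕ
⨆ {zero}  f = 0
⨆ {suc m} f = f fzero ⊔ ⨆ (f ∘ fsuc)

≤⨆ : ∀ {m} (f : Fin m → ℕ) i → f i ≤ ⨆ f
≤⨆ f fzero    = m≤m⊔n _ _
≤⨆ f (fsuc i) = m≤n⇒m≤o⊔n (f fzero) (≤⨆ (f ∘ fsuc) i)

reach : ∀ {n} → Term n → ℕ
reach (var x)     = 0
reach (read f)    = ⨆ (reach ∘ f)
reach (write γ p) = reach p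
reach (lmove p)   = suc (reach p)
reach (rmove p)   = suc (reach p)

move-budget : ∀ {B b} w d c → ∣ w - c ∣ ℕ.+ (∣ d ∣ ℕ.+ b) ≤ B → ∣ (w + d) - c ∣ ℕ.+ b ≤ B
move-budget {b = b} w d c h =
  ≤-trans (+-monoˡ-≤ b (dist-move w d c)) (≤-trans (≤-reflexive (+-assoc _ ∣ d ∣ b)) h)

confined-by-reach : ∀ {n B c w} (p : Term n) → ∣ w - c ∣ ℕ.+ reach p ≤ B → Confined B c w p
confined-by-reach (var x)     h = var
confined-by-reach (read f)    h =
  read (m+n≤o⇒m≤o _ h) (λ γ → confined-by-reach (f γ) (≤-trans (+-monoʳ-≤ _ (≤⨆ (reach ∘ f) γ)) h))
confined-by-reach (write γ p) h = write (m+n≤o⇒m≤o _ h) (confined-by-reach p h)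
confined-by-reach {c = c} {w} (lmove p) h = lmove (confined-by-reach p (move-budget w (- 1ℤ) c h))
confined-by-reach {c = c} {w} (rmove p) h = rmove (confined-by-reach p (move-budget w 1ℤ c h))

confined-at-start : ∀ {n B} {p : Term n} → reach p ≤ B → ∀ z → Confined B z z p
confined-at-start {p = p} h z =
  confined-by-reach p (subst (λ d → d ℕ.+ reach p ≤ _) (Eq.sym (∣i-i∣≡0 z)) h)

maxReach : ∀ {n} → List (Equation n) → ℕ
maxReach []            = 0
maxReach ((p , q) ∷ E) = (reach p ⊔ reach q) ⊔ maxReach E

reach≤maxReach : ∀ {n} {p q : Term n} E → (p , q) ∈ E → reach p ≤ maxReach E × reach q ≤ maxReach E
reach≤maxReach ((p , q) ∷ E) (here refl) =
  m≤n⇒m≤n⊔o (maxReach E) (m≤m⊔n (reach p) (reach q)) ,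
  m≤n⇒m≤n⊔o (maxReach E) (m≤n⊔m (reach p) (reach q))
reach≤maxReach (_ ∷ E) (there h) =
  m≤n⇒m≤o⊔n _ (proj₁ (reach≤maxReach E h)) , m≤n⇒m≤o⊔n _ (proj₂ (reach≤maxReach E h))

-- Aliased tapes

InjectiveOnBalls : ℕ → (ℤ → ℤ) → Set
InjectiveOnBalls B π = ∀ c {j j'} → ∣ j - c ∣ ≤ B → ∣ j' - c ∣ ≤ B → π j ≡ π j' → j ≡ j'

-- The head position j addresses the physical cell π j; a run returns the
-- variable it ends in.
module Aliased {n : ℕ} (π : ℤ → ℤ) where

  exec : Term n → ℤ → Tape n → ℕ × ℤ × Tape n
  exec (var x)     z τ = x , z , τ
  exec (read f)    z τ = exec (f (τ (π z))) z τ
  exec (write γ p) z τ = exec p z (τ [ π z ↦ γ ])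
  exec (lmove p)   z τ = exec p (z - 1ℤ) τ
  exec (rmove p)   z τ = exec p (z + 1ℤ) τ

  Holds : Term n → Term n → Set
  Holds p q = ∀ z τ → exec p z τ ≋ exec q z τ

  exec-cong : ∀ p z {τ τ' : Tape n} → (∀ j → τ j ≡ τ' j) → exec p z τ ≋ exec p z τ'
  exec-cong (var x)     z τ≡τ' = refl , refl , τ≡τ'
  exec-cong (read f)    z {τ} {τ'} τ≡τ' rewrite τ≡τ' (π z) = exec-cong (f (τ' (π z))) z τ≡τ'
  exec-cong (write γ p) z {τ} {τ'} τ≡τ' = exec-cong p z written
    where
    written : ∀ j → (τ [ π z ↦ γ ]) j ≡ (τ' [ π z ↦ γ ]) j
    written j with j ℤ.≟ π z
    ... | yes _ = refl
    ... | no _  = τ≡τ' j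
  exec-cong (lmove p)   z τ≡τ' = exec-cong p _ τ≡τ'
  exec-cong (rmove p)   z τ≡τ' = exec-cong p _ τ≡τ'

  continue : (ℕ → Term n) → ℕ × ℤ × Tape n → ℕ × ℤ × Tape n
  continue s (x , z , τ) = exec (s x) z τ

  exec-sub : ∀ s p z τ → exec (sub s p) z τ ≡ continue s (exec p z τ)
  exec-sub s (var x)     z τ = refl
  exec-sub s (read f)    z τ = exec-sub s (f (τ (π z))) z τ
  exec-sub s (write γ p) z τ = exec-sub s p z _
  exec-sub s (lmove p)   z τ = exec-sub s p _ τ
  exec-sub s (rmove p)   z τ = exec-sub s p _ τ

  continue-cong : ∀ s {a b} → a ≋ b → continue s a ≋ continue s b
  continue-cong s {x , z , τ} {_ , _ , _} (refl , refl , τ≡τ') = exec-cong (s x) z τ≡τ'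

  Holds-sub : ∀ s {p q} → Holds p q → Holds (sub s p) (sub s q)
  Holds-sub s {p} {q} h z τ =
    subst₂ _≋_ (Eq.sym (exec-sub s p z τ)) (Eq.sym (exec-sub s q z τ)) (continue-cong s (h z τ))

  Holds-sub-var : ∀ {p q} → Holds (sub var p) (sub var q) → Holds p q
  Holds-sub-var {p} {q} h z τ = subst₂ _≋_ (exec-sub var p z τ) (exec-sub var q z τ) (h z τ)

  sound : ∀ {E p q} → (∀ {p q} → (p , q) ∈ E → Holds p q) → E ⊢ p ≈ q → Holds p q
  sound ax (axiom {p} {q} h s) = Holds-sub s {p} {q} (ax h)
  sound ax refl                z τ = ≋-refl _
  sound ax (sym d)             z τ = ≋-sym (sound ax d z τ)
  sound ax (trans d d')        z τ = ≋-trans (sound ax d z τ) (sound ax d' z τ)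
  sound ax (cong-read d)       z τ = sound ax (d (τ (π z))) z τ
  sound ax (cong-write d)      z τ = sound ax d z _
  sound ax (cong-lmove d)      z τ = sound ax d _ τ
  sound ax (cong-rmove d)      z τ = sound ax d _ τ

  exec-writeAt : ∀ L γ p z τ → exec (writeAt L γ p) z τ ≡ exec p z (τ [ π (z + + L) ↦ γ ])
  exec-writeAt = writeAt-law exec π (λ _ _ _ → refl) (λ _ _ _ → refl) (λ _ _ _ _ → refl)

  -- Tracks τ σ: the physical tape τ of a run started at c on τ₀ represents the
  -- logical tape σ of the same run in the free model ⟦_⟧ pure.
  module Simulation (B : ℕ) (π-inj : InjectiveOnBalls B π) (c : ℤ) (τ₀ : Tape n) where

    record Tracks (τ σ : Tape n) : Set where
      field
        agrees    : ∀ j → ∣ j - c ∣ ≤ B → τ (π j) ≡ σ j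
        unchanged : ∀ a → τ a ≡ τ₀ a ⊎ ∃[ j ] (∣ j - c ∣ ≤ B × π j ≡ a)

    Simulates : ℕ × ℤ × Tape n → ℕ × ℤ × Tape n → Set
    Simulates (x , w , τ) (y , w' , σ) = x ≡ y × w ≡ w' × Tracks τ σ

    tracks-write : ∀ {w γ τ σ} → ∣ w - c ∣ ≤ B → Tracks τ σ →
                   Tracks (τ [ π w ↦ γ ]) (σ [ w ↦ γ ])
    tracks-write {w} {γ} {τ} {σ} hw t = record { agrees = agrees ; unchanged = unchanged }
      where
      agrees : ∀ j → ∣ j - c ∣ ≤ B → (τ [ π w ↦ γ ]) (π j) ≡ (σ [ w ↦ γ ]) j
      agrees j hj with π j ℤ.≟ π w | j ℤ.≟ w
      ... | yes _    | yes _    = refl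
      ... | yes πj≡πw | no j≢w  = ⊥-elim (j≢w (π-inj c hj hw πj≡πw))
      ... | no πj≢πw | yes refl = ⊥-elim (πj≢πw refl)
      ... | no _     | no _     = Tracks.agrees t j hj
      unchanged : ∀ a → (τ [ π w ↦ γ ]) a ≡ τ₀ a ⊎ ∃[ j ] (∣ j - c ∣ ≤ B × π j ≡ a)
      unchanged a with a ℤ.≟ π w
      ... | yes a≡πw = inj₂ (w , hw , Eq.sym a≡πw)
      ... | no _     = Tracks.unchanged t a

    simulate : ∀ {w p τ σ} → Confined B c w p → Tracks τ σ →
               Simulates (exec p w τ) (⟦ p ⟧ pure w σ)
    simulate var           t = refl , refl , t
    simulate {w} {σ = σ} (read hw cf) t rewrite Tracks.agrees t w hw = simulate (cf (σ w)) t
    simulate (write hw cp) t = simulate cp (tracks-write hw t)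
    simulate (lmove cp)    t = simulate cp t
    simulate (rmove cp)    t = simulate cp t

    -- A physical cell is either untouched by both runs or the image of a
    -- logical cell, on which the free results agree.
    reflect-≋ : ∀ {a b a' b'} → Simulates a a' → Simulates b b' → a' ≋ b' → a ≋ b
    reflect-≋ {_ , _ , τ₁} {_ , _ , τ₂} {_ , _ , _} {_ , _ , _}
              (refl , refl , t₁) (refl , refl , t₂) (refl , refl , σ₁≡σ₂) = refl , refl , τ₁≡τ₂
      where
      through : ∀ j → ∣ j - c ∣ ≤ B → τ₁ (π j) ≡ τ₂ (π j)
      through j hj =
        Eq.trans (Tracks.agrees t₁ j hj) (Eq.trans (σ₁≡σ₂ j) (Eq.sym (Tracks.agrees t₂ j hj)))
      τ₁≡τ₂ : ∀ a → τ₁ a ≡ τ₂ a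
      τ₁≡τ₂ a with Tracks.unchanged t₁ a | Tracks.unchanged t₂ a
      ... | inj₁ u₁              | inj₁ u₂              = Eq.trans u₁ (Eq.sym u₂)
      ... | inj₂ (j , hj , refl) | _                    = through j hj
      ... | inj₁ _               | inj₂ (j , hj , refl) = through j hj

  valid⇒holds : ∀ B → InjectiveOnBalls B π → ∀ {p q} →
                (∀ z → Confined B z z p) → (∀ z → Confined B z z q) → Valid p q → Holds p q
  valid⇒holds B π-inj cp cq valid z τ =
    reflect-≋ (simulate (cp z) start) (simulate (cq z) start) (valid ℕ pure z (τ ∘ π))
    where
    open Simulation B π-inj z τ
    start : Tracks τ (τ ∘ π)
    start = record { agrees = λ _ _ → refl ; unchanged = λ _ → inj₁ refl }

-- Folding the cell L onto the cell 0

fold : ℕ → ℤ → ℤ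
fold L j = if does (j ℤ.≟ + L) then 0ℤ else j

fold-L : ∀ L → fold L (+ L) ≡ 0ℤ
fold-L L = cong (λ b → if b then 0ℤ else + L) (dec-true (+ L ℤ.≟ + L) refl)

far-apart : ∀ {B L} → B ℕ.+ B < L → ∀ c → ∣ + L - c ∣ ≤ B → ¬ ∣ 0ℤ - c ∣ ≤ B
far-apart {B} {L} 2B<L c hL h0 =
  <-irrefl refl (≤-trans 2B<L (subst (_≤ B ℕ.+ B) (+-identityʳ L)
                                 (≤-trans (dist-triangle (+ L) 0ℤ c) (+-mono-≤ hL h0))))

fold-injectiveOnBalls : ∀ {B L} → B ℕ.+ B < L → InjectiveOnBalls B (fold L)
fold-injectiveOnBalls {B} {L} 2B<L c {j} {j'} hj hj' e with j ℤ.≟ + L | j' ℤ.≟ + L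
... | yes refl | yes refl = refl
... | yes refl | no _     = ⊥-elim (far-apart 2B<L c hj (subst (λ i → ∣ i - c ∣ ≤ B) (Eq.sym e) hj'))
... | no _     | yes refl = ⊥-elim (far-apart 2B<L c hj' (subst (λ i → ∣ i - c ∣ ≤ B) e hj))
... | no _     | no _     = e

writeThenWriteAt writeAtThenWrite : ∀ {n} → ℕ → Fin n → Fin n → Term n
writeThenWriteAt L a b = write a (writeAt L b (var 0))
writeAtThenWrite L a b = writeAt L b (write a (var 0))

distant-writes-commute : ∀ {n} L (a b : Fin n) →
                         Valid (writeThenWriteAt (suc L) a b) (writeAtThenWrite (suc L) a b)
distant-writes-commute L a b X v z σ =
  subst₂ _≋_ (Eq.sym (⟦writeAt⟧ (suc L) b (var 0) v z (σ [ z ↦ a ])))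
             (Eq.sym (⟦writeAt⟧ (suc L) b (write a (var 0)) v z σ))
             (run-cong (v 0) z (update-comm σ a b (i≢i+suc z L)))

folded-writes-collide : ∀ {n} L (a b : Fin n) → a ≢ b →
  ¬ Aliased.Holds (fold (suc L)) (writeThenWriteAt (suc L) a b) (writeAtThenWrite (suc L) a b)
folded-writes-collide {n} L a b a≢b holds = a≢b (begin
  a                                     ≡⟨ update-same (τ [ 0ℤ ↦ b ]) 0ℤ a ⟨
  ((τ [ 0ℤ ↦ b ]) [ 0ℤ ↦ a ]) 0ℤ        ≡⟨ cong (λ x → ((τ [ x ↦ b ]) [ 0ℤ ↦ a ]) 0ℤ) (fold-L (suc L)) ⟨
  ((τ [ π (+ suc L) ↦ b ]) [ 0ℤ ↦ a ]) 0ℤ ≡⟨ cell0-after-writes ⟨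
  ((τ [ 0ℤ ↦ a ]) [ π (+ suc L) ↦ b ]) 0ℤ ≡⟨ cong (λ x → ((τ [ 0ℤ ↦ a ]) [ x ↦ b ]) 0ℤ) (fold-L (suc L)) ⟩
  ((τ [ 0ℤ ↦ a ]) [ 0ℤ ↦ b ]) 0ℤ        ≡⟨ update-same (τ [ 0ℤ ↦ a ]) 0ℤ b ⟩
  b                                     ∎)
  where
  π = fold (suc L)
  open Aliased {n} π
  τ : Tape n
  τ _ = a
  cell0-after-writes : ((τ [ 0ℤ ↦ a ]) [ π (+ suc L) ↦ b ]) 0ℤ ≡ ((τ [ π (+ suc L) ↦ b ]) [ 0ℤ ↦ a ]) 0ℤ
  cell0-after-writes = proj₂ (proj₂ (subst₂ _≋_ (exec-writeAt (suc L) b (var 0) 0ℤ (τ [ 0ℤ ↦ a ]))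
                                                (exec-writeAt (suc L) b (write a (var 0)) 0ℤ τ)
                                                (holds 0ℤ τ))) 0ℤ

theorem1 : (n : ℕ) → 2 ≤ n →
    ¬ Σ (List (Equation n)) (λ E → Axiomatizes E)
theorem1 (suc zero) (ℕ.s≤s ())
theorem1 (suc (suc m)) _ (E , axiomatizes) =
  folded-writes-collide L a b (λ ()) (sound axioms-hold derivable)
  where
  a b : Fin (suc (suc m))
  a = fzero
  b = fsuc fzero
  B = maxReach E
  L = B ℕ.+ B
  open Aliased (fold (suc L))
  derivable : E ⊢ writeThenWriteAt (suc L) a b ≈ writeAtThenWrite (suc L) a b
  derivable = proj₂ (axiomatizes (_ , _)) (distant-writes-commute L a b)
  axioms-hold : ∀ {p q} → (p , q) ∈ E → Holds p q
  axioms-hold {p} {q} p≈q∈E = Holds-sub-var {p} {q}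
    (valid⇒holds B (fold-injectiveOnBalls ≤-refl)
      (confined-sub-var ∘ confined-at-start {p = p} (proj₁ (reach≤maxReach E p≈q∈E)))
      (confined-sub-var ∘ confined-at-start {p = q} (proj₂ (reach≤maxReach E p≈q∈E)))
      (proj₁ (axiomatizes (sub var p , sub var q)) (axiom p≈q∈E var)))
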